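{- Let $P$ be a program, $b_0$ a boolean variable of $P$, and $A^*,B^*$ infinite sets over which equality is decidable. In the following, $A$ and $B$ range over non-empty finite subsets of $A^*$ and $B^*$ respectively. (1) For every formula $\overline{\varphi}$ of the universal fragment $\overline{L^\mu_2}$ of the $\mu$-calculus over the boolean variables of $P$: if $[\![P]\!]^*_{A^*,B^*}, b_0\models\overline{\varphi}$, then $[\![P]\!]_{A,B}, b_0\models\overline{\varphi}$ for all such $A,B$. (2) For every formula $\overline{\varphi}$ of the universal disjunction-free fragment $\overline{L^\mu_4}$ over the boolean variables of $P$: $[\![P]\!]^*_{A^*,B^*}, b_0\models\overline{\varphi}$ if and only if $[\![P]\!]_{A,B}, b_0\models\overline{\varphi}$ for all such $A,B$.
   Context: Transition systems are $(Q,\delta,[\![\cdot]\!],\mathcal{O})$: state space $Q$, successor function $\delta:Q\to 2^Q$, finite observables $\mathcal{O}$, extensions $[\![\cdot]\!]:\mathcal{O}\to 2^Q$. $\mu$-calculus: formulas $\varphi ::= p\mid\overline{p}\mid h\mid\varphi\vee\varphi\mid\varphi\wedge\varphi\mid\exists\bigcirc\varphi\mid\forall\bigcirc\varphi\mid(\mu h:\varphi)\mid(\nu h:\varphi)$ ($p$ observable, $h$ variable), with semantics relative to an environment $\mathcal{E}$: $[\![p]\!]_\mathcal{E}=[\![p]\!]$, $[\![\overline{p}]\!]_\mathcal{E}=Q\setminus[\![p]\!]$, $[\![h]\!]_\mathcal{E}=\mathcal{E}(h)$, $\vee,\wedge$ as union and intersection, $[\![\exists\bigcirc\varphi]\!]_\mathcal{E}=\{s:\exists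 s'\in\delta(s),\ s'\in[\![\varphi]\!]_\mathcal{E}\}$, $[\![\forall\bigcirc\varphi]\!]_\mathcal{E}=\{s:\forall s'\in\delta(s),\ s'\in[\![\varphi]\!]_\mathcal{E}\}$, $[\![\mu h:\varphi]\!]_\mathcal{E}$ (resp. $\nu$) the intersection (resp. union) of all $\tau\subseteq Q$ with $\tau=[\![\varphi]\!]_{\mathcal{E}[h\mapsto\tau]}$. Only closed formulas are considered; $\mathcal{S},s\models\varphi$ means $s\in[\![\varphi]\!]_\mathcal{E}$, and for a boolean variable $b_0$, $\mathcal{S},b_0\models\varphi$ means $\mathcal{S},s\models\varphi$ for every $s\in[\![b_0]\!]$. $L^\mu_2$ is the set of closed formulas without $\overline{p}$ and $\forall\bigcirc$; $L^\mu_4$ is the subset of $L^\mu_2$ without $\wedge$ and $\nu$. The dual $\overline{L}$ of such a logic $L$ consists of the formulas $\overline{\varphi}$ obtained from $\varphi\in L$ by replacing $p,\overline{p},\vee,\wedge,\exists\bigcirc,\forall\bigcirc,\mu,\nu$ by $\overline{p},p,\wedge,\vee,\forall\bigcirc,\exists\bigcirc,\nu,\mu$ respectively (so $\overline{L^\mu_2}$ is the universal fragment and $\overline{L^\mu_4}$ the universal disjunction-free fragment). Programs. Fix type symbols $X,Y$. A program $P$ has finitely many typed variables (boolean variables, $X$-variables, $Y$-variables, array variables indexed by $X$ storing $Y$) and finitely many guarded commands $e\longrightarrow I$, with boolean expressions $e ::= \mathbf{true}\mid\mathbf{false}\mid b\mid z=z'\mid\neg e\mid e\vee e$ ($z,z'$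 data variables of the same type). A command $I$ contains for each boolean $b$ at most one $b:=e$; for each data variable $z$ at most one of $z:=z'$, $z:=\,?$ (nondeterministic choice), or (for $z$ of type $Y$) a read $z:=a[x]$; for each array $a$ at most one write $a[x]:=y$. $E_s(e)$ is the usual evaluation of $e$ in state $s$. Normal semantics $[\![P]\!]_{A,B}$ ($A$ instantiating $X$, $B$ instantiating $Y$): states map booleans to truth values, $X$-variables into $A$, $Y$-variables into $B$, arrays to total functions $A\to B$; $s'\in\delta(s)$ iff some guarded command $e\longrightarrow I$ has $E_s(e)=\mathbf{true}$ and $s\,\Delta_I\,s'$, where $s\,\Delta_I\,s'$ iff (i) $s'(b)=E_s(e)$ if $b:=e\in I$, else $s'(b)=s(b)$; (ii) for data variables $z$: if $z:=z'\in I$ then $s'(z)=s(z')$, else if $z:=a[x]\in I$ then $s'(z)=s(a)(s(x))$, else either $z:=\,?\in I$ or $s'(z)=s(z)$; (iii) for arrays $a$ and $v\in A$: if $a[x]:=y\in I$ with $s(x)=v$ then $s'(a)(v)=s(y)$, else $s'(a)(v)=s(a)(v)$. Observables are the boolean variables with $[\![b]\!]=\{s:s(b)=\mathbf{true}\}$. Partial-functions semantics $[\![P]\!]^*_{A^*,B^*}$ ($A^*,B^*$ infinite): as the normal semantics except that each array $a$ is mapped to a partial function $s(a)$ from $A^*$ to $B^*$ with finite domain, defined at $s(x)$ for all $X$-variables $x$ ($\bot$ denotes undefined; $\bot=\bot$, $\bot\ne w$), and $\Delta_I$ is replaced by $\Delta^*_I$: (i),(ii) as before and (iii*) for each array $a$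 and $v\in A^*$: if $a[x]:=y\in I$ with $s(x)=v$ then $s'(a)(v)=s(y)$; otherwise, if there is no $X$-variable $x$ with $x:=\,?\in I$, $s'(x)=v$ and $s(a)(v)=\bot$, then $s'(a)(v)=s(a)(v)$. -}

module Defs where

open import Data.Nat using (ℕ)
import Data.Nat as ℕ
open import Data.Fin using (Fin)
open import Data.Bool using (Bool; true; false; T; if_then_else_; not; _∨_)
open import Data.Bool.Properties using (T-irrelevant)
open import Data.Maybe using (Maybe; just; nothing; maybe)
open import Data.Product using (Σ; Σ-syntax; _×_; _,_; ∃; ∃-syntax; proj₁; proj₂)
open import Data.Product.Properties using (≡-dec)
open import Data.Sum using (_⊎_)
open import Data.List using (List; []; _∷_)
open import Data.List.Membership.Propositional using (_∈_; _∉_)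
open import Data.Empty using (⊥)
open import Data.Unit using (⊤)
open import Level using (Lift)
open import Relation.Nullary using (¬_; Dec; yes; no; does)
open import Relation.Binary.PropositionalEquality using (_≡_; _≢_)
open import Relation.Binary.Definitions using (DecidableEquality)

data Exp (nb nx ny : ℕ) : Set where
  tt ff : Exp nb nx ny
  bvar  : Fin nb → Exp nb nx ny
  eqX   : Fin nx → Fin nx → Exp nb nx ny
  eqY   : Fin ny → Fin ny → Exp nb nx ny
  neg   : Exp nb nx ny → Exp nb nx ny
  disj  : Exp nb nx ny → Exp nb nx ny → Exp nb nx ny

-- what a command does to an X-variable: nothing, x := x', or x := ?
data XAct (nx : ℕ) : Set where
  keepX  : XAct nx
  copyX  : Fin nx → XAct nx
  havocX : XAct nx

-- what a command does to a Y-variable: nothing, y := y', y := ?, y := a[x]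
data YAct (nx ny na : ℕ) : Set where
  keepY  : YAct nx ny na
  copyY  : Fin ny → YAct nx ny na
  havocY : YAct nx ny na
  readY  : Fin na → Fin nx → YAct nx ny na

record Cmd (nb nx ny na : ℕ) : Set where
  field
    bAsg : Fin nb → Maybe (Exp nb nx ny)
    xAsg : Fin nx → XAct nx
    yAsg : Fin ny → YAct nx ny na
    aWr  : Fin na → Maybe (Fin nx × Fin ny)   -- a[x] := y

record Program : Set where
  field
    nb nx ny na : ℕ
    cmds : List (Exp nb nx ny × Cmd nb nx ny na)

record TS (nb : ℕ) : Set₁ where
  field
    Q   : Set
    δ   : Q → Q → Set
    obs : Fin nb → Q → Set

record FinSubset (C : Set) : Set where
  field
    mem       : C → Bool
    elems     : List C
    complete  : ∀ c → T (mem c) → c ∈ elems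
    inhabited : Σ[ c ∈ C ] T (mem c)

Carrier : {C : Set} → FinSubset C → Set
Carrier {C} F = Σ[ c ∈ C ] T (FinSubset.mem F c)

Carrier-≟ : {C : Set} → DecidableEquality C → (F : FinSubset C) → DecidableEquality (Carrier F)
Carrier-≟ dC F = ≡-dec dC (λ x y → yes (T-irrelevant x y))

Infinite : Set → Set
Infinite C = (xs : List C) → ∃[ c ] c ∉ xs

module Sem (P : Program) where
  open Program P

  evalE : {A B : Set} → DecidableEquality A → DecidableEquality B →
          (Fin nb → Bool) → (Fin nx → A) → (Fin ny → B) → Exp nb nx ny → Bool
  evalE dA dB β ξ η tt = true
  evalE dA dB β ξ η ff = false
  evalE dA dB β ξ η (bvar b) = β b
  evalE dA dB β ξ η (eqX x x') = does (dA (ξ x) (ξ x'))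
  evalE dA dB β ξ η (eqY y y') = does (dB (η y) (η y'))
  evalE dA dB β ξ η (neg e) = not (evalE dA dB β ξ η e)
  evalE dA dB β ξ η (disj e e') = evalE dA dB β ξ η e ∨ evalE dA dB β ξ η e'

  BStep : {A B : Set} → DecidableEquality A → DecidableEquality B →
          (Fin nb → Bool) → (Fin nx → A) → (Fin ny → B) →
          Cmd nb nx ny na → (Fin nb → Bool) → Set
  BStep dA dB β ξ η I β' =
    ∀ b → β' b ≡ maybe (evalE dA dB β ξ η) (β b) (Cmd.bAsg I b)

  XRel : {A : Set} → (Fin nx → A) → XAct nx → A → A → Set
  XRel ξ keepX      new old = new ≡ old
  XRel ξ (copyX x') new old = new ≡ ξ x'
  XRel ξ havocX     new old = ⊤

  -- clause (ii) for Y-variables; rd a x w says "s(a)(s(x)) is w"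
  YRel : {B : Set} → (Fin ny → B) → (Fin na → Fin nx → B → Set) →
         YAct nx ny na → B → B → Set
  YRel η rd keepY       new old = new ≡ old
  YRel η rd (copyY y')  new old = new ≡ η y'
  YRel η rd havocY      new old = ⊤
  YRel η rd (readY a x) new old = rd a x new

  hit : {A : Set} → DecidableEquality A → (Fin nx → A) →
        Maybe (Fin nx × Fin ny) → A → Bool
  hit dA ξ nothing v = false
  hit dA ξ (just (x , y)) v = does (dA (ξ x) v)

  -- value written by a write instruction (used only when hit is true)
  written : {A B : Set} → (Fin ny → B) → Maybe (Fin nx × Fin ny) → (B → Set) → Set
  written η nothing K = ⊤
  written η (just (x , y)) K = K (η y)

  record NState (A B : Set) : Set where
    field
      bv : Fin nb → Bool
      xv : Fin nx → A
      yv : Fin ny → B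
      av : Fin na → A → B

  module _ {A B : Set} (dA : DecidableEquality A) (dB : DecidableEquality B) where
    open NState

    ΔN : Cmd nb nx ny na → NState A B → NState A B → Set
    ΔN I s s' =
      BStep dA dB (bv s) (xv s) (yv s) I (bv s')
      × (∀ x → XRel (xv s) (Cmd.xAsg I x) (xv s' x) (xv s x))
      × (∀ y → YRel (yv s) (λ a x w → w ≡ av s a (xv s x)) (Cmd.yAsg I y) (yv s' y) (yv s y))
      × (∀ a v → if hit dA (xv s) (Cmd.aWr I a) v
                 then written {A} (yv s) (Cmd.aWr I a) (λ w → av s' a v ≡ w)
                 else av s' a v ≡ av s a v)

    normalTS : TS nb
    normalTS = record
      { Q   = NState A B
      ; δ   = λ s s' → Σ[ g ∈ Exp nb nx ny × Cmd nb nx ny na ]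
                         g ∈ cmds
                         × evalE dA dB (bv s) (xv s) (yv s) (proj₁ g) ≡ true
                         × ΔN (proj₂ g) s s'
      ; obs = λ b s → bv s b ≡ true
      }

  ⟦_⟧N : {A* B* : Set} → DecidableEquality A* → DecidableEquality B* →
         FinSubset A* → FinSubset B* → TS nb
  ⟦_⟧N dA dB A B = normalTS (Carrier-≟ dA A) (Carrier-≟ dB B)

  -- Partial-functions semantics ⟦P⟧*_{A*,B*}
  -- (nothing plays the role of ⊥)

  record PState (A B : Set) : Set where
    field
      bv : Fin nb → Bool
      xv : Fin nx → A
      yv : Fin ny → B
      av : Fin na → A → Maybe B
      finDom : ∀ a → ∃[ xs ] (∀ v → av a v ≢ nothing → v ∈ xs)
      defd   : ∀ a x → av a (xv x) ≢ nothing

  module _ {A B : Set} (dA : DecidableEquality A) (dB : DecidableEquality B) where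
    open PState

    ΔP : Cmd nb nx ny na → PState A B → PState A B → Set
    ΔP I s s' =
      BStep dA dB (bv s) (xv s) (yv s) I (bv s')
      × (∀ x → XRel (xv s) (Cmd.xAsg I x) (xv s' x) (xv s x))
      × (∀ y → YRel (yv s) (λ a x w → av s a (xv s x) ≡ just w) (Cmd.yAsg I y) (yv s' y) (yv s y))
      × (∀ a v → if hit dA (xv s) (Cmd.aWr I a) v
                 then written {A} (yv s) (Cmd.aWr I a) (λ w → av s' a v ≡ just w)
                 else ((¬ (∃[ x ] (Cmd.xAsg I x ≡ havocX × xv s' x ≡ v × av s a v ≡ nothing)))
                       → av s' a v ≡ av s a v))

    ⟦_⟧P : TS nb
    ⟦_⟧P = record
      { Q   = PState A B
      ; δ   = λ s s' → Σ[ g ∈ Exp nb nx ny × Cmd nb nx ny na ]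
                         g ∈ cmds
                         × evalE dA dB (bv s) (xv s) (yv s) (proj₁ g) ≡ true
                         × ΔP (proj₂ g) s s'
      ; obs = λ b s → bv s b ≡ true
      }

data Form (nb : ℕ) : Set where
  prop nprop : Fin nb → Form nb
  var        : ℕ → Form nb
  _∨f_ _∧f_  : Form nb → Form nb → Form nb
  ex all     : Form nb → Form nb
  μf νf      : ℕ → Form nb → Form nb

ClosedIn : {nb : ℕ} → List ℕ → Form nb → Set
ClosedIn Γ (prop p) = ⊤
ClosedIn Γ (nprop p) = ⊤
ClosedIn Γ (var h) = h ∈ Γ
ClosedIn Γ (φ ∨f ψ) = ClosedIn Γ φ × ClosedIn Γ ψ
ClosedIn Γ (φ ∧f ψ) = ClosedIn Γ φ × ClosedIn Γ ψ
ClosedIn Γ (ex φ) = ClosedIn Γ φ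
ClosedIn Γ (all φ) = ClosedIn Γ φ
ClosedIn Γ (μf h φ) = ClosedIn (h ∷ Γ) φ
ClosedIn Γ (νf h φ) = ClosedIn (h ∷ Γ) φ

Closed : {nb : ℕ} → Form nb → Set
Closed = ClosedIn []

-- no negated observables, no ∀○  (closedness is required separately)
InL2 : {nb : ℕ} → Form nb → Set
InL2 (prop p) = ⊤
InL2 (nprop p) = ⊥
InL2 (var h) = ⊤
InL2 (φ ∨f ψ) = InL2 φ × InL2 ψ
InL2 (φ ∧f ψ) = InL2 φ × InL2 ψ
InL2 (ex φ) = InL2 φ
InL2 (all φ) = ⊥
InL2 (μf h φ) = InL2 φ
InL2 (νf h φ) = InL2 φ

InL4 : {nb : ℕ} → Form nb → Set
InL4 (prop p) = ⊤
InL4 (nprop p) = ⊥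
InL4 (var h) = ⊤
InL4 (φ ∨f ψ) = InL4 φ × InL4 ψ
InL4 (φ ∧f ψ) = ⊥
InL4 (ex φ) = InL4 φ
InL4 (all φ) = ⊥
InL4 (μf h φ) = InL4 φ
InL4 (νf h φ) = ⊥

dual : {nb : ℕ} → Form nb → Form nb
dual (prop p) = nprop p
dual (nprop p) = prop p
dual (var h) = var h
dual (φ ∨f ψ) = dual φ ∧f dual ψ
dual (φ ∧f ψ) = dual φ ∨f dual ψ
dual (ex φ) = all (dual φ)
dual (all φ) = ex (dual φ)
dual (μf h φ) = νf h (dual φ)
dual (νf h φ) = μf h (dual φ)

module _ {nb : ℕ} (𝒮 : TS nb) where
  open TS 𝒮

  Env : Set₁
  Env = ℕ → Q → Set

  _[_↦_] : Env → ℕ → (Q → Set) → Env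
  (ℰ [ h ↦ τ ]) h' = if does (h ℕ.≟ h') then τ else ℰ h'

  ⟦_⟧ : Form nb → Env → Q → Set₁
  ⟦ prop p ⟧ ℰ s = Lift _ (obs p s)
  ⟦ nprop p ⟧ ℰ s = Lift _ (¬ obs p s)
  ⟦ var h ⟧ ℰ s = Lift _ (ℰ h s)
  ⟦ φ ∨f ψ ⟧ ℰ s = ⟦ φ ⟧ ℰ s ⊎ ⟦ ψ ⟧ ℰ s
  ⟦ φ ∧f ψ ⟧ ℰ s = ⟦ φ ⟧ ℰ s × ⟦ ψ ⟧ ℰ s
  ⟦ ex φ ⟧ ℰ s = Σ[ s' ∈ Q ] (δ s s' × ⟦ φ ⟧ ℰ s')
  ⟦ all φ ⟧ ℰ s = (s' : Q) → δ s s' → ⟦ φ ⟧ ℰ s'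
  ⟦ μf h φ ⟧ ℰ s = (τ : Q → Set) →
      (∀ q → (τ q → ⟦ φ ⟧ (ℰ [ h ↦ τ ]) q) × (⟦ φ ⟧ (ℰ [ h ↦ τ ]) q → τ q)) → τ s
  ⟦ νf h φ ⟧ ℰ s = Σ[ τ ∈ (Q → Set) ]
      ((∀ q → (τ q → ⟦ φ ⟧ (ℰ [ h ↦ τ ]) q) × (⟦ φ ⟧ (ℰ [ h ↦ τ ]) q → τ q)) × τ s)

  -- 𝒮, b₀ ⊨ φ  (φ closed; the environment is irrelevant, we use the empty one)
  _⊨_ : Fin nb → Form nb → Set₁
  b₀ ⊨ φ = (s : Q) → obs b₀ s → ⟦ φ ⟧ (λ _ _ → ⊥) s

{-# OPTIONS --safe #-}
-- Part (1) and the forward half of (2): restricting its arrays to A turns a normal state over finite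
-- A ⊆ A*, B ⊆ B* into a partial state, and this embedding maps transitions to transitions and
-- preserves the observables.  Universal formulas (duals of L²) are reflected along any such
-- homomorphism of transition systems.
--
-- Backward half of (2): for φ in L⁴ (no ∧, no ν) the dual of φ holds at every state where φ has no
-- finite witness, i.e. a single finite run together with unfoldings of the μ-binders along it.  Given
-- a witness, the values occurring on its run determine finite A and B and a normal run mirroring the
-- partial one, which reads each array cell from the first state of the run at which the cell is
-- defined (a defined cell only changes by a write, so this is consistent with every step).  The
-- witness transfers to that normal run, contradicting the hypothesis there.
--
-- The semantics of μ and ν quantifies over all predicates Q → Set and so lives in Set₁; the
-- Knaster–Tarski principles therefore need fixed points that live in Set.  They exist because every
-- formula denotes an indexed container, and containers have least fixed points (well-founded trees)
-- and greatest fixed points (coherent sequences of finite approximants).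
module Submission where

open import Defs
open import Data.Bool using (Bool; true; false; T; not; _∨_; if_then_else_)
open import Data.Bool.Properties using (T-irrelevant)
open import Data.Container.Indexed using (_▷_; _◃_/_; Command; Response; next) renaming (⟦_⟧ to ⟦_⟧ⁱ)
open import Data.Container.Indexed.Combinator using (const; _⊎′_) renaming (_×_ to _⊗_)
open import Data.Empty using (⊥)
open import Data.Fin using (Fin)
open import Data.List using (List; []; _∷_; _++_; tabulate; concatMap; fromMaybe; allFin)
open import Data.List.Membership.Propositional using (_∈_; lose)
open import Data.List.Membership.Propositional.Properties
  using (∈-++⁺ˡ; ∈-++⁺ʳ; ∈-tabulate⁺; ∈-allFin; ∈-concatMap⁺)
import Data.List.Membership.DecPropositional as DecMembership
open import Data.List.Relation.Binary.Subset.Propositional using (_⊆_)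
import Data.List.Relation.Unary.Any as Any
open import Data.List.Relation.Unary.Any using (here; there)
open import Data.Maybe using (Maybe; just; nothing; maybe′; _<∣>_)
open import Data.Nat using (ℕ; zero; suc)
import Data.Nat as ℕ
open import Data.Product using (Σ; Σ-syntax; ∃-syntax; _×_; _,_; proj₁; proj₂; uncurry)
open import Data.Sum using (_⊎_; inj₁; inj₂)
open import Data.Unit using (⊤; tt)
open import Function using (_∘_; id)
open import Function.Bundles using (_⇔_; mk⇔; Equivalence)
open import Level using (Lift; lift; lower)
open import Relation.Nullary using (¬_; Dec; yes; no; does; contradiction)
open import Relation.Nullary.Decidable using (does-⇔; dec-true; dec-false; ⌊_⌋; toWitness; fromWitness)
open import Relation.Binary.Definitions using (DecidableEquality)
open import Relation.Binary.PropositionalEquality using (_≡_; _≢_; refl; sym; trans; subst; cong; cong₂)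

module _ {P X : Set} {τ σ : X → Set} {x : X} where

  if-intro : (d : Dec P) → (P → τ x) → (¬ P → σ x) → (if does d then τ else σ) x
  if-intro (yes p) hit miss = hit p
  if-intro (no ¬p) hit miss = miss ¬p

  if-hit : (d : Dec P) → P → (if does d then τ else σ) x → τ x
  if-hit (yes _) p  v = v
  if-hit (no ¬p) p  v = contradiction p ¬p

  if-miss : (d : Dec P) → ¬ P → (if does d then τ else σ) x → σ x
  if-miss (yes p) ¬p v = contradiction p ¬p
  if-miss (no _)  ¬p v = v

if-map : ∀ {P X Y : Set} {τ σ : X → Set} {τ′ σ′ : Y → Set} {x y} (d : Dec P) →
         (τ x → τ′ y) → (σ x → σ′ y) →
         (if does d then τ else σ) x → (if does d then τ′ else σ′) y
if-map (yes _) hit miss = hit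
if-map (no _)  hit miss = miss

if-yes : ∀ {P A : Set} (d : Dec P) {a b : A} → P → (if does d then a else b) ≡ a
if-yes (yes _) p = refl
if-yes (no ¬p) p = contradiction p ¬p

if-no : ∀ {P A : Set} (d : Dec P) {a b : A} → ¬ P → (if does d then a else b) ≡ b
if-no (yes p) ¬p = contradiction p ¬p
if-no (no _)  ¬p = refl

if-true : ∀ {ℓ} {X Y : Set ℓ} {b} → b ≡ true → (if b then X else Y) → X
if-true refl x = x

if-false : ∀ {ℓ} {X Y : Set ℓ} {b} → b ≡ false → (if b then X else Y) → Y
if-false refl y = y

module FixedPoints {nb : ℕ} (𝒮 : TS nb) where
  open TS 𝒮

  _[_≔_] : Env 𝒮 → ℕ → (Q → Set) → Env 𝒮
  _[_≔_] = _[_↦_] 𝒮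

  ⟦_⟧ᶠ : Form nb → Env 𝒮 → Q → Set₁
  ⟦_⟧ᶠ = ⟦_⟧ 𝒮

  Con : Set₁
  Con = (ℕ × Q) ▷ Q

  ⟦_⟧ᶜ : Con → Env 𝒮 → Q → Set
  ⟦ C ⟧ᶜ ℰ = ⟦ C ⟧ⁱ (uncurry ℰ)

  varᶜ : ℕ → Con
  varᶜ h = (λ _ → ⊤) ◃ (λ _ → ⊤) / λ {q} _ _ → h , q

  ◇ᶜ : Con → Con
  ◇ᶜ C .Command q            = Σ[ q′ ∈ Q ] δ q q′ × Command C q′
  ◇ᶜ C .Response (_ , _ , c) = Response C c
  ◇ᶜ C .next     (_ , _ , c) = next C c

  □ᶜ : Con → Con
  □ᶜ C .Command q           = (q′ : Q) → δ q q′ → Command C q′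
  □ᶜ C .Response {q} c      = Σ[ q′ ∈ Q ] Σ[ d ∈ δ q q′ ] Response C (c q′ d)
  □ᶜ C .next c (q′ , d , r) = next C (c q′ d) r

  module _ (C : Con) (k : ℕ) where

    Recurs : ∀ {q} (c : Command C q) → Response C c → Set
    Recurs c r = k ≡ proj₁ (next C c r)

    data Tree : Q → Set where
      node : ∀ {q} (c : Command C q) → (∀ r → Recurs c r → Tree (proj₂ (next C c r))) → Tree q

    data Leaf : ∀ {q} → Tree q → Set where
      stop : ∀ {q c ts} r → ¬ Recurs c r → Leaf (node {q} c ts)
      down : ∀ {q c ts} r (l : Recurs c r) → Leaf (ts r l) → Leaf (node {q} c ts)

    leafNext : ∀ {q} {t : Tree q} → Leaf t → ℕ × Q
    leafNext (stop {c = c} r _) = next C c r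
    leafNext (down r l π)       = leafNext π

    μᶜ : Con
    μᶜ = Tree ◃ Leaf / λ _ → leafNext

    module _ (ℰ : Env 𝒮) where

      μᶜ-fold : ∀ {q} → ⟦ C ⟧ᶜ (ℰ [ k ≔ ⟦ μᶜ ⟧ᶜ ℰ ]) q → ⟦ μᶜ ⟧ᶜ ℰ q
      μᶜ-fold (c , g) = node c (λ r l → proj₁ (kid r l)) , leaves
        where
        kid : ∀ r → Recurs c r → ⟦ μᶜ ⟧ᶜ ℰ (proj₂ (next C c r))
        kid r l = if-hit (k ℕ.≟ _) l (g r)
        leaves : (π : Leaf (node c (λ r l → proj₁ (kid r l)))) → uncurry ℰ (leafNext π)
        leaves (stop r ¬l)  = if-miss (k ℕ.≟ _) ¬l (g r)
        leaves (down r l π) = proj₂ (kid r l) π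

      μᶜ-unfold : ∀ {q} → ⟦ μᶜ ⟧ᶜ ℰ q → ⟦ C ⟧ᶜ (ℰ [ k ≔ ⟦ μᶜ ⟧ᶜ ℰ ]) q
      μᶜ-unfold (node c ts , L) =
        c , λ r → if-intro (k ℕ.≟ _) (λ l → ts r l , L ∘ down r l) (L ∘ stop r)

      μᶜ-least : (τ : Q → Set) → (∀ {q} → ⟦ C ⟧ᶜ (ℰ [ k ≔ τ ]) q → τ q) →
                 ∀ {q} → ⟦ μᶜ ⟧ᶜ ℰ q → τ q
      μᶜ-least τ pre (t , L) = go t L
        where
        go : ∀ {q} (t : Tree q) → ((π : Leaf t) → uncurry ℰ (leafNext π)) → τ q
        go (node c ts) L =
          pre (c , λ r → if-intro (k ℕ.≟ _) (λ l → go (ts r l) (L ∘ down r l)) (L ∘ stop r))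

    -- Trees cut off at depth n; an element of νᶜ is a coherent family of such truncations.
    Approx : ℕ → Q → Set
    Kids : ℕ → ∀ {q} → Command C q → Set
    Approx zero    q = ⊤
    Approx (suc n) q = Σ (Command C q) (Kids n)
    Kids n c = ∀ r → Recurs c r → Approx n (proj₂ (next C c r))

    ALeaf : ∀ n {q} → Approx n q → Set
    ALeaf zero    _       = ⊥
    ALeaf (suc n) (c , a) = (Σ[ r ∈ Response C c ] ¬ Recurs c r)
                          ⊎ (Σ[ r ∈ Response C c ] Σ[ l ∈ Recurs c r ] ALeaf n (a r l))

    aleafNext : ∀ n {q} (a : Approx n q) → ALeaf n a → ℕ × Q
    aleafNext (suc n) (c , a) (inj₁ (r , _))     = next C c r
    aleafNext (suc n) (c , a) (inj₂ (r , l , π)) = aleafNext n (a r l) π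

    Coh : ∀ n {q} → Approx (suc n) q → Approx n q → Set
    CohKids : ∀ n {q} {c c′ : Command C q} → c ≡ c′ → Kids (suc n) c → Kids n c′ → Set
    Coh zero    _       _         = ⊤
    Coh (suc n) (c , a) (c′ , a′) = Σ[ e ∈ c ≡ c′ ] CohKids n e a a′
    CohKids n refl a a′ = ∀ r l → Coh n (a r l) (a′ r l)

    Coherent : ∀ {q} → (∀ n → Approx n q) → Set
    Coherent a = ∀ n → Coh n (a (suc n)) (a n)

    νᶜ : Con
    νᶜ = (λ q → Σ (∀ n → Approx n q) Coherent)
       ◃ (λ (a , _) → Σ[ n ∈ ℕ ] ALeaf n (a n))
       / (λ (a , _) (n , π) → aleafNext n (a n) π)

    CohKids-subst : ∀ n {q} {c c₁ c₂ : Command C q} (e : c₁ ≡ c₂) (e₁ : c₁ ≡ c) (e₂ : c₂ ≡ c)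
                    {a₁ : Kids (suc n) c₁} {a₂ : Kids n c₂} → CohKids n e a₁ a₂ →
                    CohKids n refl (subst (Kids (suc n)) e₁ a₁) (subst (Kids n) e₂ a₂)
    CohKids-subst n refl refl refl coh = coh

    ALeaf-subst : ∀ n {q} {c c′ : Command C q} (e : c′ ≡ c) (a : Kids n c′) r (l : Recurs c r)
                  (π : ALeaf n (subst (Kids n) e a r l)) →
                  Σ[ π′ ∈ ALeaf (suc n) (c′ , a) ] aleafNext (suc n) (c′ , a) π′ ≡ aleafNext n _ π
    ALeaf-subst n refl a r l π = inj₂ (r , l , π) , refl

    module _ (ℰ : Env 𝒮) where

      νᶜ-fold : ∀ {q} → ⟦ C ⟧ᶜ (ℰ [ k ≔ ⟦ νᶜ ⟧ᶜ ℰ ]) q → ⟦ νᶜ ⟧ᶜ ℰ q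
      νᶜ-fold {q} (c , g) = (approx , coherent) , leaves
        where
        kid : ∀ r → Recurs c r → ⟦ νᶜ ⟧ᶜ ℰ (proj₂ (next C c r))
        kid r l = if-hit (k ℕ.≟ _) l (g r)
        approx : ∀ n → Approx n q
        approx zero    = tt
        approx (suc n) = c , λ r l → proj₁ (proj₁ (kid r l)) n
        coherent : Coherent approx
        coherent zero    = tt
        coherent (suc n) = refl , λ r l → proj₂ (proj₁ (kid r l)) n
        leaves : ((n , π) : Σ[ n ∈ ℕ ] ALeaf n (approx n)) → uncurry ℰ (aleafNext n (approx n) π)
        leaves (suc n , inj₁ (r , ¬l))    = if-miss (k ℕ.≟ _) ¬l (g r)
        leaves (suc n , inj₂ (r , l , π)) = proj₂ (kid r l) (n , π)

      νᶜ-unfold : ∀ {q} → ⟦ νᶜ ⟧ᶜ ℰ q → ⟦ C ⟧ᶜ (ℰ [ k ≔ ⟦ νᶜ ⟧ᶜ ℰ ]) q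
      νᶜ-unfold ((a , coh) , L) = c , λ r → if-intro (k ℕ.≟ _) (kid r) (λ ¬l → L (1 , inj₁ (r , ¬l)))
        where
        c = proj₁ (a 1)
        root : ∀ n → proj₁ (a (suc n)) ≡ c
        root zero    = refl
        root (suc n) = trans (proj₁ (coh (suc n))) (root n)
        kids : ∀ n → Kids n c
        kids n = subst (Kids n) (root n) (proj₂ (a (suc n)))
        kids-coherent : ∀ n → CohKids n refl (kids (suc n)) (kids n)
        kids-coherent n =
          CohKids-subst n (proj₁ (coh (suc n))) (root (suc n)) (root n) (proj₂ (coh (suc n)))
        kid : ∀ r → Recurs c r → ⟦ νᶜ ⟧ᶜ ℰ (proj₂ (next C c r))
        kid r l = ((λ n → kids n r l) , λ n → kids-coherent n r l)
                , λ (n , π) → let (π′ , e) = ALeaf-subst n (root n) (proj₂ (a (suc n))) r l π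
                              in subst (uncurry ℰ) e (L (suc n , π′))

      νᶜ-greatest : (τ : Q → Set) → (∀ {q} → τ q → ⟦ C ⟧ᶜ (ℰ [ k ≔ τ ]) q) →
                    ∀ {q} → τ q → ⟦ νᶜ ⟧ᶜ ℰ q
      νᶜ-greatest τ post x = ((λ n → approx n x) , λ n → coherent n x) , λ (n , π) → leaves n x π
        where
        kid : ∀ {q} (x : τ q) r → Recurs (proj₁ (post x)) r → τ (proj₂ (next C _ r))
        kid x r l = if-hit (k ℕ.≟ _) l (proj₂ (post x) r)
        approx : ∀ n {q} → τ q → Approx n q
        approx zero    x = tt
        approx (suc n) x = proj₁ (post x) , λ r l → approx n (kid x r l)
        coherent : ∀ n {q} (x : τ q) → Coh n (approx (suc n) x) (approx n x)
        coherent zero    x = tt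
        coherent (suc n) x = refl , λ r l → coherent n (kid x r l)
        leaves : ∀ n {q} (x : τ q) (π : ALeaf n (approx n x)) →
                 uncurry ℰ (aleafNext n (approx n x) π)
        leaves (suc n) x (inj₁ (r , ¬l))    = if-miss (k ℕ.≟ _) ¬l (proj₂ (post x) r)
        leaves (suc n) x (inj₂ (r , l , π)) = leaves n (kid x r l) π

  con : Form nb → Con
  con (prop p)  = const (obs p)
  con (nprop p) = const (¬_ ∘ obs p)
  con (var h)   = varᶜ h
  con (φ ∨f ψ)  = con φ ⊎′ con ψ
  con (φ ∧f ψ)  = con φ ⊗ con ψ
  con (ex φ)    = ◇ᶜ (con φ)
  con (all φ)   = □ᶜ (con φ)
  con (μf k φ)  = μᶜ (con φ) k
  con (νf k φ)  = νᶜ (con φ) k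

  con⁺ : ∀ φ {ℰ q} → ⟦ φ ⟧ᶠ ℰ q → ⟦ con φ ⟧ᶜ ℰ q
  con⁻ : ∀ φ {ℰ q} → ⟦ con φ ⟧ᶜ ℰ q → ⟦ φ ⟧ᶠ ℰ q
  con⁺ (prop p)  x = lower x , λ ()
  con⁺ (nprop p) x = lower x , λ ()
  con⁺ (var h)   x = tt , λ _ → lower x
  con⁺ (φ ∨f ψ) (inj₁ x) = let (c , g) = con⁺ φ x in inj₁ c , g
  con⁺ (φ ∨f ψ) (inj₂ y) = let (c , g) = con⁺ ψ y in inj₂ c , g
  con⁺ (φ ∧f ψ) (x , y) =
    let (c , g) = con⁺ φ x ; (c′ , g′) = con⁺ ψ y
    in (c , c′) , λ { (inj₁ r) → g r ; (inj₂ r) → g′ r }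
  con⁺ (ex φ) (q′ , d , x) = let (c , g) = con⁺ φ x in (q′ , d , c) , g
  con⁺ (all φ) x =
    (λ q′ d → proj₁ (con⁺ φ (x q′ d))) , λ (q′ , d , r) → proj₂ (con⁺ φ (x q′ d)) r
  con⁺ (μf k φ) {ℰ} x = x (⟦ μᶜ (con φ) k ⟧ᶜ ℰ) λ _ →
    (λ m → con⁻ φ (μᶜ-unfold (con φ) k ℰ m)) , (λ y → μᶜ-fold (con φ) k ℰ (con⁺ φ y))
  con⁺ (νf k φ) {ℰ} (τ , fix , x) = νᶜ-greatest (con φ) k ℰ τ (λ y → con⁺ φ (proj₁ (fix _) y)) x
  con⁻ (prop p)  (o , _)  = lift o
  con⁻ (nprop p) (¬o , _) = lift ¬o
  con⁻ (var h)   (_ , g)  = lift (g tt)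
  con⁻ (φ ∨f ψ) (inj₁ c , g) = inj₁ (con⁻ φ (c , g))
  con⁻ (φ ∨f ψ) (inj₂ c , g) = inj₂ (con⁻ ψ (c , g))
  con⁻ (φ ∧f ψ) ((c , c′) , g) = con⁻ φ (c , g ∘ inj₁) , con⁻ ψ (c′ , g ∘ inj₂)
  con⁻ (ex φ) ((q′ , d , c) , g) = q′ , d , con⁻ φ (c , g)
  con⁻ (all φ) (c , g) q′ d = con⁻ φ (c q′ d , λ r → g (q′ , d , r))
  con⁻ (μf k φ) {ℰ} m τ fix = μᶜ-least (con φ) k ℰ τ (λ c → proj₂ (fix _) (con⁻ φ c)) m
  con⁻ (νf k φ) {ℰ} m = ⟦ νᶜ (con φ) k ⟧ᶜ ℰ , (λ _ →
    (λ n → con⁻ φ (νᶜ-unfold (con φ) k ℰ n)) , (λ y → νᶜ-fold (con φ) k ℰ (con⁺ φ y))) , m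

  μ-least : ∀ k φ {ℰ} (τ : Q → Set) → (∀ {q} → ⟦ φ ⟧ᶠ (ℰ [ k ≔ τ ]) q → τ q) →
            ∀ {q} → ⟦ μf k φ ⟧ᶠ ℰ q → τ q
  μ-least k φ {ℰ} τ pre x = μᶜ-least (con φ) k ℰ τ (λ c → pre (con⁻ φ c)) (con⁺ (μf k φ) x)

  ν-greatest : ∀ k φ {ℰ} (τ : Q → Set) → (∀ {q} → τ q → ⟦ φ ⟧ᶠ (ℰ [ k ≔ τ ]) q) →
               ∀ {q} → τ q → ⟦ νf k φ ⟧ᶠ ℰ q
  ν-greatest k φ {ℰ} τ post x =
    con⁻ (νf k φ) (νᶜ-greatest (con φ) k ℰ τ (λ y → con⁺ φ (post y)) x)

module Homomorphism {nb : ℕ} (𝒜 𝒞 : TS nb) (f : TS.Q 𝒞 → TS.Q 𝒜)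
                    (obs-preserved : ∀ {p t} → TS.obs 𝒞 p t → TS.obs 𝒜 p (f t))
                    (δ-preserved : ∀ {t t′} → TS.δ 𝒞 t t′ → TS.δ 𝒜 (f t) (f t′)) where
  module A = FixedPoints 𝒜
  module C = FixedPoints 𝒞

  _≼_ : Env 𝒜 → Env 𝒞 → Set
  ℰ ≼ ℰ′ = ∀ h t → ℰ h (f t) → ℰ′ h t

  ≼-update : ∀ {ℰ ℰ′} k {τ τ′} → ℰ ≼ ℰ′ → (∀ {t} → τ (f t) → τ′ t) →
             (ℰ A.[ k ≔ τ ]) ≼ (ℰ′ C.[ k ≔ τ′ ])
  ≼-update k ℰ≼ℰ′ τ⊆τ′ h t = if-map (k ℕ.≟ h) τ⊆τ′ (ℰ≼ℰ′ h t)

  dual-reflected : ∀ φ → InL2 φ → ∀ {ℰ ℰ′} → ℰ ≼ ℰ′ →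
                   ∀ {t} → A.⟦ dual φ ⟧ᶠ ℰ (f t) → C.⟦ dual φ ⟧ᶠ ℰ′ t
  dual-reflected (prop p) _ _ x = lift (lower x ∘ obs-preserved)
  dual-reflected (var h) _ ℰ≼ℰ′ x = lift (ℰ≼ℰ′ h _ (lower x))
  dual-reflected (φ ∨f ψ) (i , j) ℰ≼ℰ′ (x , y) =
    dual-reflected φ i ℰ≼ℰ′ x , dual-reflected ψ j ℰ≼ℰ′ y
  dual-reflected (φ ∧f ψ) (i , j) ℰ≼ℰ′ (inj₁ x) = inj₁ (dual-reflected φ i ℰ≼ℰ′ x)
  dual-reflected (φ ∧f ψ) (i , j) ℰ≼ℰ′ (inj₂ y) = inj₂ (dual-reflected ψ j ℰ≼ℰ′ y)
  dual-reflected (ex φ) i ℰ≼ℰ′ x t′ d = dual-reflected φ i ℰ≼ℰ′ (x (f t′) (δ-preserved d))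
  dual-reflected (μf k φ) i ℰ≼ℰ′ (τ , fix , x) =
    C.ν-greatest k (dual φ) (τ ∘ f) (dual-reflected φ i (≼-update k ℰ≼ℰ′ id) ∘ proj₁ (fix _)) x
  dual-reflected (νf k φ) i ℰ≼ℰ′ x τ′ fix =
    -- induction with the predicate "every f-preimage lies in τ′", which is prefixed by the hypothesis
    A.μ-least k (dual φ) (λ a → ∀ {t′} → f t′ ≡ a → τ′ t′) pre x refl
    where
    pre : ∀ {a} → A.⟦ dual φ ⟧ᶠ _ a → ∀ {t′} → f t′ ≡ a → τ′ t′
    pre y refl = proj₂ (fix _) (dual-reflected φ i (≼-update k ℰ≼ℰ′ (λ z → z refl)) y)

-- An environment ρ : Closures nb maps a bound variable h to its μ-binder together with the
-- environment in scope at that binder, so that an occurrence of h can be unfolded again.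
data Closure (nb : ℕ) : Set where
  closure : ℕ → Form nb → (ℕ → Maybe (Closure nb)) → Closure nb

Closures : ℕ → Set
Closures nb = ℕ → Maybe (Closure nb)

_[_≔ᶜ_] : ∀ {nb} → Closures nb → ℕ → Closure nb → Closures nb
(ρ [ k ≔ᶜ c ]) h = if does (k ℕ.≟ h) then just c else ρ h

module Witnesses {nb : ℕ} (𝒮 : TS nb) where
  open TS 𝒮
  open FixedPoints 𝒮

  data Witness : Form nb → Closures nb → Q → Set where
    prop   : ∀ {p ρ q} → obs p q → Witness (prop p) ρ q
    var    : ∀ {h k φ ρ ρ′ q} → ρ h ≡ just (closure k φ ρ′) → Witness (μf k φ) ρ′ q →
             Witness (var h) ρ q
    orˡ    : ∀ {φ ψ ρ q} → Witness φ ρ q → Witness (φ ∨f ψ) ρ q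
    orʳ    : ∀ {φ ψ ρ q} → Witness ψ ρ q → Witness (φ ∨f ψ) ρ q
    ex     : ∀ {φ ρ q q′} → δ q q′ → Witness φ ρ q′ → Witness (ex φ) ρ q
    unfold : ∀ {k φ ρ q} → Witness φ (ρ [ k ≔ᶜ closure k φ ρ ]) q → Witness (μf k φ) ρ q

  Agrees : Maybe (Closure nb) → (Q → Set) → Set₁
  Agrees nothing _ = Lift _ ⊤
  Agrees (just (closure k φ ρ)) τ =
    Σ[ ℰ ∈ Env 𝒮 ] (∀ h → Agrees (ρ h) (ℰ h)) × (∀ {q} → τ q → ⟦ νf k (dual φ) ⟧ᶠ ℰ q)

  witness⇒¬dual : ∀ {φ ρ q} → Witness φ ρ q →
                  ∀ {ℰ} → (∀ h → Agrees (ρ h) (ℰ h)) → ¬ ⟦ dual φ ⟧ᶠ ℰ q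
  witness⇒¬dual (prop o) _ x = lower x o
  witness⇒¬dual {ρ = ρ} (var {h} eq w) agree x with ρ h | eq | agree h
  ... | _ | refl | ℰ′ , agree′ , ⊆ν = witness⇒¬dual w agree′ (⊆ν (lower x))
  witness⇒¬dual (orˡ w) agree (x , _) = witness⇒¬dual w agree x
  witness⇒¬dual (orʳ w) agree (_ , y) = witness⇒¬dual w agree y
  witness⇒¬dual (ex d w) agree x = witness⇒¬dual w agree (x _ d)
  witness⇒¬dual {ρ = ρ} (unfold {k} {φ} w) {ℰ} agree (τ , fix , x) =
    witness⇒¬dual w agree′ (proj₁ (fix _) x)
    where
    agree′ : ∀ h → Agrees ((ρ [ k ≔ᶜ closure k φ ρ ]) h) ((ℰ [ k ≔ τ ]) h)
    agree′ h = go (k ℕ.≟ h)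
      where
      go : (d : Dec (k ≡ h)) →
           Agrees (if does d then just (closure k φ ρ) else ρ h) (if does d then τ else ℰ h)
      go (yes _) = ℰ , agree , λ y → τ , fix , y
      go (no _)  = agree h

  ¬witness⇒dual : ∀ {φ Γ} → ClosedIn Γ φ → InL4 φ → ∀ {ρ ℰ} →
                  (∀ {h} → h ∈ Γ → ∀ {q} → ¬ Witness (var h) ρ q → ℰ h q) →
                  ∀ {q} → ¬ Witness φ ρ q → ⟦ dual φ ⟧ᶠ ℰ q
  ¬witness⇒dual {prop p} _ _ _ nw = lift (nw ∘ prop)
  ¬witness⇒dual {var h} h∈Γ _ hyp nw = lift (hyp h∈Γ nw)
  ¬witness⇒dual {φ ∨f ψ} (cφ , cψ) (iφ , iψ) hyp nw =
    ¬witness⇒dual cφ iφ hyp (nw ∘ orˡ) , ¬witness⇒dual cψ iψ hyp (nw ∘ orʳ)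
  ¬witness⇒dual {ex φ} c i hyp nw _ d = ¬witness⇒dual c i hyp (nw ∘ ex d)
  ¬witness⇒dual {μf k φ} {Γ} c i {ρ} {ℰ} hyp nw =
    ν-greatest k (dual φ) τ (λ nw′ → ¬witness⇒dual c i hyp′ (nw′ ∘ unfold)) nw
    where
    τ : Q → Set
    τ q = ¬ Witness (μf k φ) ρ q
    hyp′ : ∀ {h} → h ∈ k ∷ Γ →
           ∀ {q} → ¬ Witness (var h) (ρ [ k ≔ᶜ closure k φ ρ ]) q → (ℰ [ k ≔ τ ]) h q
    hyp′ {h} h∈kΓ nv = if-intro (k ℕ.≟ h)
      (λ k≡h w → nv (var (if-yes (k ℕ.≟ h) k≡h) w))
      (λ k≢h → hyp (Any.tail (k≢h ∘ sym) h∈kΓ)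
                   λ { (var eq w) → nv (var (trans (if-no (k ℕ.≟ h) k≢h) eq) w) })

InL4⇒InL2 : ∀ {nb} (φ : Form nb) → InL4 φ → InL2 φ
InL4⇒InL2 (prop p) _       = _
InL4⇒InL2 (var h)  _       = _
InL4⇒InL2 (φ ∨f ψ) (i , j) = InL4⇒InL2 φ i , InL4⇒InL2 ψ j
InL4⇒InL2 (ex φ)   i       = InL4⇒InL2 φ i
InL4⇒InL2 (μf k φ) i       = InL4⇒InL2 φ i

Carrier-≡ : ∀ {C : Set} (F : FinSubset C) {u v : Carrier F} → proj₁ u ≡ proj₁ v → u ≡ v
Carrier-≡ F {c , p} {.c , p′} refl = cong (c ,_) (T-irrelevant p p′)

does-Carrier-≟ : ∀ {C : Set} (dC : DecidableEquality C) (F : FinSubset C) (u v : Carrier F) →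
                 does (Carrier-≟ dC F u v) ≡ does (dC (proj₁ u) (proj₁ v))
does-Carrier-≟ dC F u v = does-⇔ (mk⇔ (cong proj₁) (Carrier-≡ F)) (Carrier-≟ dC F u v) (dC _ _)

onlyIf : ∀ {X : Set} (b : Bool) → (T b → X) → Maybe X
onlyIf true  f = just (f tt)
onlyIf false f = nothing

onlyIf-defined : ∀ {X : Set} b {f : T b → X} → onlyIf b f ≢ nothing → T b
onlyIf-defined true  _   = tt
onlyIf-defined false def = contradiction refl def

onlyIf-at : ∀ {X : Set} b (t : T b) (f : T b → X) → onlyIf b f ≡ just (f t)
onlyIf-at true tt f = refl

onlyIf-total : ∀ {X : Set} b (t : T b) (f : T b → X) → onlyIf b f ≢ nothing
onlyIf-total true tt f ()

onlyIf-cong : ∀ {X : Set} b {f g : T b → X} → (∀ t → f t ≡ g t) → onlyIf b f ≡ onlyIf b g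
onlyIf-cong true  f≗g = cong just (f≗g tt)
onlyIf-cong false f≗g = refl

restrict : ∀ {C X : Set} (F : FinSubset C) → (Carrier F → X) → C → Maybe X
restrict F g c = onlyIf (FinSubset.mem F c) λ c∈F → g (c , c∈F)

listSubset : ∀ {C : Set} → DecidableEquality C → C → List C → FinSubset C
listSubset dC c cs = record
  { mem       = λ x → ⌊ x ∈? c ∷ cs ⌋
  ; elems     = c ∷ cs
  ; complete  = λ _ → toWitness
  ; inhabited = c , fromWitness (here refl)
  }
  where open DecMembership dC

module Programs (P : Program) {A* B* : Set} (dA : DecidableEquality A*) (dB : DecidableEquality B*) where
  open Program P
  open Sem P

  𝒫 : TS nb
  𝒫 = ⟦_⟧P dA dB

  𝒩 : FinSubset A* → FinSubset B* → TS nb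
  𝒩 = ⟦_⟧N dA dB

  module OverCarriers (A : FinSubset A*) (B : FinSubset B*) where
    private
      dA′ = Carrier-≟ dA A
      dB′ = Carrier-≟ dB B

    evalE-Carrier : ∀ β (ξ : Fin nx → Carrier A) (η : Fin ny → Carrier B) e →
                    evalE dA′ dB′ β ξ η e ≡ evalE dA dB β (proj₁ ∘ ξ) (proj₁ ∘ η) e
    evalE-Carrier β ξ η tt          = refl
    evalE-Carrier β ξ η ff          = refl
    evalE-Carrier β ξ η (bvar b)    = refl
    evalE-Carrier β ξ η (eqX x x′)  = does-Carrier-≟ dA A (ξ x) (ξ x′)
    evalE-Carrier β ξ η (eqY y y′)  = does-Carrier-≟ dB B (η y) (η y′)
    evalE-Carrier β ξ η (neg e)     = cong not (evalE-Carrier β ξ η e)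
    evalE-Carrier β ξ η (disj e e′) = cong₂ _∨_ (evalE-Carrier β ξ η e) (evalE-Carrier β ξ η e′)

    maybe-evalE-Carrier : ∀ β (ξ : Fin nx → Carrier A) (η : Fin ny → Carrier B) {b} m →
                          maybe′ (evalE dA′ dB′ β ξ η) b m
                          ≡ maybe′ (evalE dA dB β (proj₁ ∘ ξ) (proj₁ ∘ η)) b m
    maybe-evalE-Carrier β ξ η nothing  = refl
    maybe-evalE-Carrier β ξ η (just e) = evalE-Carrier β ξ η e

    BStep-Carrier : ∀ β (ξ : Fin nx → Carrier A) (η : Fin ny → Carrier B) I β′ →
                    BStep dA′ dB′ β ξ η I β′ ⇔ BStep dA dB β (proj₁ ∘ ξ) (proj₁ ∘ η) I β′
    BStep-Carrier β ξ η I β′ =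
      mk⇔ (λ bs b → trans (bs b) (maybe-evalE-Carrier β ξ η (Cmd.bAsg I b)))
          (λ bs b → trans (bs b) (sym (maybe-evalE-Carrier β ξ η (Cmd.bAsg I b))))

    XRel-Carrier : ∀ (ξ : Fin nx → Carrier A) act {new old : Carrier A} →
                   XRel ξ act new old ⇔ XRel (proj₁ ∘ ξ) act (proj₁ new) (proj₁ old)
    XRel-Carrier ξ keepX      = mk⇔ (cong proj₁) (Carrier-≡ A)
    XRel-Carrier ξ (copyX x′) = mk⇔ (cong proj₁) (Carrier-≡ A)
    XRel-Carrier ξ havocX     = mk⇔ _ _

    YRel-Carrier⁺ : ∀ (η : Fin ny → Carrier B) {rd rd′} act {new old : Carrier B} →
                    (∀ {a x} → rd a x new → rd′ a x (proj₁ new)) →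
                    YRel η rd act new old → YRel (proj₁ ∘ η) rd′ act (proj₁ new) (proj₁ old)
    YRel-Carrier⁺ η keepY       read = cong proj₁
    YRel-Carrier⁺ η (copyY y′)  read = cong proj₁
    YRel-Carrier⁺ η havocY      read = _
    YRel-Carrier⁺ η (readY a x) read = read

    YRel-Carrier⁻ : ∀ (η : Fin ny → Carrier B) {rd rd′} act {new old : Carrier B} →
                    (∀ {a x} → rd′ a x (proj₁ new) → rd a x new) →
                    YRel (proj₁ ∘ η) rd′ act (proj₁ new) (proj₁ old) → YRel η rd act new old
    YRel-Carrier⁻ η keepY       read = Carrier-≡ B
    YRel-Carrier⁻ η (copyY y′)  read = Carrier-≡ B
    YRel-Carrier⁻ η havocY      read = _
    YRel-Carrier⁻ η (readY a x) read = read

  module Embedding (A : FinSubset A*) (B : FinSubset B*) where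
    open OverCarriers A B
    open FinSubset
    open NState
    private
      dA′ = Carrier-≟ dA A

    NS : Set
    NS = NState (Carrier A) (Carrier B)

    embed : NS → PState A* B*
    embed t = record
      { bv     = bv t
      ; xv     = proj₁ ∘ xv t
      ; yv     = proj₁ ∘ yv t
      ; av     = λ a → restrict A (proj₁ ∘ av t a)
      ; finDom = λ a → elems A , λ v def → complete A v (onlyIf-defined (mem A v) def)
      ; defd   = λ a x → onlyIf-total _ (proj₂ (xv t x)) _
      }

    embed-array : ∀ (ξ : Fin nx → Carrier A) (η : Fin ny → Carrier B) m {old new : Carrier A → Carrier B}
                  {K : A* → Set} →
      (∀ u → if hit dA′ ξ m u then written {Carrier A} η m (λ w → new u ≡ w) else new u ≡ old u) →
      ∀ v → if hit dA (proj₁ ∘ ξ) m v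
            then written {A*} (proj₁ ∘ η) m (λ w → restrict A (proj₁ ∘ new) v ≡ just w)
            else (K v → restrict A (proj₁ ∘ new) v ≡ restrict A (proj₁ ∘ old) v)
    embed-array ξ η nothing cell v _ = onlyIf-cong (mem A v) λ t → cong proj₁ (cell (v , t))
    embed-array ξ η (just (x , y)) cell v with dA (proj₁ (ξ x)) v
    ... | yes refl = trans (onlyIf-at _ (proj₂ (ξ x)) _)
                           (cong (just ∘ proj₁) (if-true (dec-true (dA′ (ξ x) (ξ x)) refl) (cell (ξ x))))
    ... | no x≢v   = λ _ → onlyIf-cong (mem A v) λ t →
      cong proj₁ (if-false (dec-false (dA′ (ξ x) (v , t)) (x≢v ∘ cong proj₁)) (cell (v , t)))

    embed-δ : ∀ {t t′} → TS.δ (𝒩 A B) t t′ → TS.δ 𝒫 (embed t) (embed t′)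
    embed-δ {t} {t′} ((e , I) , g∈ , guard , bs , xs , ys , arr) =
      (e , I) , g∈ , trans (sym (evalE-Carrier (bv t) (xv t) (yv t) e)) guard ,
      Equivalence.to (BStep-Carrier (bv t) (xv t) (yv t) I (bv t′)) bs ,
      (λ x → Equivalence.to (XRel-Carrier (xv t) (Cmd.xAsg I x)) (xs x)) ,
      (λ y → YRel-Carrier⁺ (yv t) (Cmd.yAsg I y) read (ys y)) ,
      (λ a → embed-array (xv t) (yv t) (Cmd.aWr I a) (arr a))
      where
      read : ∀ {w : Carrier B} {a x} → w ≡ av t a (xv t x) →
             restrict A (proj₁ ∘ av t a) (proj₁ (xv t x)) ≡ just (proj₁ w)
      read refl = onlyIf-at _ (proj₂ (xv t _)) _

  PS : Set
  PS = PState A* B*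

  data Run : PS → Set where
    done : ∀ {s} → Run s
    step : ∀ {s s′} → TS.δ 𝒫 s s′ → Run s′ → Run s

  along : ∀ {X : Set} → (PS → List X) → ∀ {s} → Run s → List X
  along f {s} done       = f s
  along f {s} (step _ r) = f s ++ along f r

  along-head : ∀ {X : Set} (f : PS → List X) {s} (r : Run s) → f s ⊆ along f r
  along-head f done       = id
  along-head f (step _ r) = ∈-++⁺ˡ

  firstDefined : ∀ {s} → Run s → Fin na → A* → Maybe B*
  firstDefined {s} done       a v = PState.av s a v
  firstDefined {s} (step _ r) a v = PState.av s a v <∣> firstDefined r a v

  firstDefined-head : ∀ {s} (r : Run s) {a v w} → PState.av s a v ≡ just w → firstDefined r a v ≡ just w
  firstDefined-head done       e = e
  firstDefined-head (step _ r) e rewrite e = refl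

  firstDefined-kept : ∀ {s s′} (r : Run s′) {a v} →
                      (∀ {w} → PState.av s a v ≡ just w → PState.av s′ a v ≡ just w) →
                      firstDefined r a v ≡ PState.av s a v <∣> firstDefined r a v
  firstDefined-kept {s} r {a} {v} keep with PState.av s a v
  ... | just w  = firstDefined-head r (keep refl)
  ... | nothing = refl

  xValues : PS → List A*
  xValues s = tabulate (PState.xv s)

  yValues : List A* → PS → List B*
  yValues As s =
    tabulate (PState.yv s) ++ concatMap (λ a → concatMap (fromMaybe ∘ PState.av s a) As) (allFin na)

  array∈yValues : ∀ {As} s a {v w} → v ∈ As → PState.av s a v ≡ just w → w ∈ yValues As s
  array∈yValues {As} s a v∈As e =
    ∈-++⁺ʳ (tabulate (PState.yv s))
      (∈-concatMap⁺ _ (lose (∈-allFin a) (∈-concatMap⁺ _ (lose v∈As w∈))))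
    where
    w∈ = subst (λ m → _ ∈ fromMaybe m) (sym e) (here refl)

  firstDefined∈ : ∀ {As s} (r : Run s) {a v w} → v ∈ As → firstDefined r a v ≡ just w →
                  w ∈ along (yValues As) r
  firstDefined∈ {As} {s} done {a} v∈As e = array∈yValues {As} s a v∈As e
  firstDefined∈ {As} {s} (step _ r) {a} {v} v∈As e with PState.av s a v in eq
  ... | just _  = ∈-++⁺ˡ (array∈yValues {As} s a v∈As (trans eq e))
  ... | nothing = ∈-++⁺ʳ _ (firstDefined∈ r v∈As e)

  open Witnesses 𝒫 using (Witness; prop; var; orˡ; orʳ; ex; unfold; ¬witness⇒dual)

  trace : ∀ {φ ρ s} → Witness φ ρ s → Run s
  trace (prop _)   = done
  trace (var _ w)  = trace w
  trace (orˡ w)    = trace w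
  trace (orʳ w)    = trace w
  trace (ex d w)   = step d (trace w)
  trace (unfold w) = trace w

  module Instance (a₀ : A*) (w₀ : B*) {s₀ : PS} (r₀ : Run s₀) where
    As : List A*
    As = a₀ ∷ along xValues r₀

    Bs : List B*
    Bs = w₀ ∷ along (yValues As) r₀

    A : FinSubset A*
    A = listSubset dA a₀ (along xValues r₀)

    B : FinSubset B*
    B = listSubset dB w₀ (along (yValues As) r₀)

    open OverCarriers A B
    open Embedding A B using (NS)

    orDefault : (m : Maybe B*) → (∀ {w} → m ≡ just w → w ∈ Bs) → Carrier B
    orDefault (just w) w∈Bs = w , fromWitness (w∈Bs refl)
    orDefault nothing  _    = w₀ , fromWitness (here refl)

    orDefault-just : ∀ {m w} (m⊆Bs : ∀ {w} → m ≡ just w → w ∈ Bs) →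
                     m ≡ just w → proj₁ (orDefault m m⊆Bs) ≡ w
    orDefault-just _ refl = refl

    orDefault-cong : ∀ {m m′} (m⊆Bs : ∀ {w} → m ≡ just w → w ∈ Bs)
                     (m′⊆Bs : ∀ {w} → m′ ≡ just w → w ∈ Bs) →
                     m ≡ m′ → proj₁ (orDefault m m⊆Bs) ≡ proj₁ (orDefault m′ m′⊆Bs)
    orDefault-cong {just _}  _ _ refl = refl
    orDefault-cong {nothing} _ _ refl = refl

    stateAt : ∀ {s} (r : Run s) → along xValues r ⊆ As → along (yValues As) r ⊆ Bs → NS
    stateAt {s} r ⊆As ⊆Bs = record
      { bv = PState.bv s
      ; xv = λ x → PState.xv s x , fromWitness (⊆As (along-head xValues r (∈-tabulate⁺ x)))
      ; yv = λ y → PState.yv s y ,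
                   fromWitness (⊆Bs (along-head (yValues As) r (∈-++⁺ˡ (∈-tabulate⁺ y))))
      ; av = λ a u → orDefault (firstDefined r a (proj₁ u))
                               (⊆Bs ∘ firstDefined∈ r (toWitness (proj₂ u)))
      }

    stateAt-δ : ∀ {s s′} (d : TS.δ 𝒫 s s′) (r : Run s′)
                (⊆As : along xValues (step {s} {s′} d r) ⊆ As)
                (⊆Bs : along (yValues As) (step {s} {s′} d r) ⊆ Bs) →
                TS.δ (𝒩 A B) (stateAt (step {s} {s′} d r) ⊆As ⊆Bs)
                             (stateAt r (⊆As ∘ ∈-++⁺ʳ _) (⊆Bs ∘ ∈-++⁺ʳ _))
    stateAt-δ {s} {s′} d@((e , I) , g∈ , guard , bs , xs , ys , arr) r ⊆As ⊆Bs =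
      (e , I) , g∈ , trans (evalE-Carrier (bv t) (xv t) (yv t) e) guard ,
      Equivalence.from (BStep-Carrier (bv t) (xv t) (yv t) I (bv t′)) bs ,
      (λ x → Equivalence.from (XRel-Carrier (xv t) (Cmd.xAsg I x)) (xs x)) ,
      (λ y → YRel-Carrier⁻ (yv t) (Cmd.yAsg I y) read (ys y)) ,
      (λ a → array a (Cmd.aWr I a) (arr a))
      where
      open NState
      t t′ : NS
      t  = stateAt (step {s} {s′} d r) ⊆As ⊆Bs
      t′ = stateAt r (⊆As ∘ ∈-++⁺ʳ _) (⊆Bs ∘ ∈-++⁺ʳ _)
      Fresh : Fin na → A* → Set
      Fresh a v = ∃[ x ] (Cmd.xAsg I x ≡ havocX × PState.xv s′ x ≡ v × PState.av s a v ≡ nothing)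
      read : ∀ {a x} {w : Carrier B} →
             PState.av s a (PState.xv s x) ≡ just (proj₁ w) → w ≡ av t a (xv t x)
      read e = Carrier-≡ B (sym (orDefault-just _ (firstDefined-head (step {s} {s′} d r) e)))
      kept : ∀ a u → (¬ Fresh a (proj₁ u) → PState.av s′ a (proj₁ u) ≡ PState.av s a (proj₁ u)) →
             av t′ a u ≡ av t a u
      kept a u keep = Carrier-≡ B (orDefault-cong _ _ (firstDefined-kept {s} r λ e →
        trans (keep λ (_ , _ , _ , e′) → contradiction (trans (sym e) e′) λ ()) e))
      array : ∀ a m → (∀ v → if hit dA (PState.xv s) m v
                             then written {A*} (PState.yv s) m (λ w → PState.av s′ a v ≡ just w)
                             else (¬ Fresh a v → PState.av s′ a v ≡ PState.av s a v)) →
              ∀ u → if hit (Carrier-≟ dA A) (xv t) m u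
                    then written {Carrier A} (yv t) m (λ w → av t′ a u ≡ w)
                    else av t′ a u ≡ av t a u
      array a nothing cell u = kept a u (cell (proj₁ u))
      array a (just (x , y)) cell (v , v∈A) with dA (PState.xv s x) v
      ... | yes refl =
        Carrier-≡ B (orDefault-just _ (firstDefined-head r (if-true (dec-true (dA _ _) refl) (cell v))))
      ... | no x≢v   = kept a (v , v∈A) (if-false (dec-false (dA _ _) x≢v) (cell v))

    module 𝒩-Witnesses = Witnesses (𝒩 A B)

    transfer : ∀ {φ ρ s} (w : Witness φ ρ s)
               (⊆As : along xValues (trace w) ⊆ As) (⊆Bs : along (yValues As) (trace w) ⊆ Bs) →
               𝒩-Witnesses.Witness φ ρ (stateAt (trace w) ⊆As ⊆Bs)
    transfer (prop o)   ⊆As ⊆Bs = 𝒩-Witnesses.prop o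
    transfer (var eq w) ⊆As ⊆Bs = 𝒩-Witnesses.var eq (transfer w ⊆As ⊆Bs)
    transfer (orˡ w)    ⊆As ⊆Bs = 𝒩-Witnesses.orˡ (transfer w ⊆As ⊆Bs)
    transfer (orʳ w)    ⊆As ⊆Bs = 𝒩-Witnesses.orʳ (transfer w ⊆As ⊆Bs)
    transfer (ex d w)   ⊆As ⊆Bs =
      𝒩-Witnesses.ex (stateAt-δ d (trace w) ⊆As ⊆Bs)
                     (transfer w (⊆As ∘ ∈-++⁺ʳ _) (⊆Bs ∘ ∈-++⁺ʳ _))
    transfer (unfold w) ⊆As ⊆Bs = 𝒩-Witnesses.unfold (transfer w ⊆As ⊆Bs)

  dualL2-partial⇒normal : ∀ {b₀} φ → InL2 φ →
                          _⊨_ 𝒫 b₀ (dual φ) → ∀ A B → _⊨_ (𝒩 A B) b₀ (dual φ)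
  dualL2-partial⇒normal φ i 𝒫⊨ A B t t⊨b₀ = dual-reflected φ i (λ _ _ ()) (𝒫⊨ (embed t) t⊨b₀)
    where
    open Embedding A B
    open Homomorphism 𝒫 (𝒩 A B) embed id embed-δ

  dualL4-normal⇒partial : A* → B* → ∀ {b₀} φ → InL4 φ → Closed φ →
                          (∀ A B → _⊨_ (𝒩 A B) b₀ (dual φ)) → _⊨_ 𝒫 b₀ (dual φ)
  dualL4-normal⇒partial a₀ w₀ φ i c 𝒩⊨ s s⊨b₀ = ¬witness⇒dual c i (λ ()) refuted
    where
    refuted : ¬ Witness φ (λ _ → nothing) s
    refuted w = 𝒩-Witnesses.witness⇒¬dual (transfer w there there) (λ _ → lift tt)
                                          (𝒩⊨ A B (stateAt (trace w) there there) s⊨b₀)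
      where open Instance a₀ w₀ (trace w)

theorem2 : (P : Program) (b₀ : Fin (Program.nb P))
           (A* B* : Set) (dA : DecidableEquality A*) (dB : DecidableEquality B*) →
           Infinite A* → Infinite B* →
           ((φ : Form (Program.nb P)) → InL2 φ → Closed φ →
              _⊨_ (Sem.⟦_⟧P P dA dB) b₀ (dual φ) →
              (A : FinSubset A*) (B : FinSubset B*) →
              _⊨_ (Sem.⟦_⟧N P dA dB A B) b₀ (dual φ))
           ×
           ((φ : Form (Program.nb P)) → InL4 φ → Closed φ →
              (_⊨_ (Sem.⟦_⟧P P dA dB) b₀ (dual φ)
                ⇔ ((A : FinSubset A*) (B : FinSubset B*) →
                     _⊨_ (Sem.⟦_⟧N P dA dB A B) b₀ (dual φ))))
theorem2 P b₀ A* B* dA dB infA infB =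
  (λ φ i _ → dualL2-partial⇒normal φ i) ,
  λ φ i c → mk⇔ (dualL2-partial⇒normal φ (InL4⇒InL2 φ i)) (dualL4-normal⇒partial a₀ w₀ φ i c)
  where
  open Programs P dA dB
  -- Infinity of A* and B* is only needed to obtain default values for the finite instances.
  a₀ : A*
  a₀ = proj₁ (infA [])
  w₀ : B*
  w₀ = proj₁ (infB [])
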